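{- Let $r,n\ge1$ be integers, $c,d\in\mathbb{Z}$, $b=\gcd(r,n)$, and $B_{c,d}$ the $r\times r$ matrix with diagonal entries $c$ and off-diagonal entries $d$. A vector $\boldsymbol{x}=(x_1,\dots,x_r)^T\in(\mathbb{Z}/n\mathbb{Z})^r$ satisfies \[(c-d)(x_i-x_r)\equiv 0\pmod n\ \ (1\le i\le r-1),\qquad (c+(r-1)d)(x_1+\cdots+x_r)\equiv 0\pmod n\] if and only if $B_{c,d}\boldsymbol{x}\equiv a\cdot\boldsymbol{1}_r\pmod n$ for some $a\in(n/b)\mathbb{Z}$.
   Context: $\boldsymbol{1}_r$ denotes the $r\times1$ column vector with all entries $1$. -}

module Defs where

open import Data.Nat using (ℕ; zero; suc)
open import Data.Nat.GCD using (gcd; gcd[m,n]∣n)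
open import Data.Nat.Divisibility using (quotient)
open import Data.Integer using (ℤ; +_; _+_; _-_; _*_)
open import Data.Integer.Divisibility using (_∣_)
open import Data.Fin using (Fin; zero; suc; _≟_)
open import Relation.Nullary.Decidable using (does)
open import Data.Bool using (if_then_else_)

infix 4 _≡_[mod_]
_≡_[mod_] : ℤ → ℤ → ℕ → Set
a ≡ b [mod n ] = (+ n) ∣ (a - b)

Σℤ : ∀ {r} → (Fin r → ℤ) → ℤ
Σℤ {zero}  f = + 0
Σℤ {suc r} f = f zero + Σℤ (λ i → f (suc i))

B : ∀ {r} → ℤ → ℤ → Fin r → Fin r → ℤ
B c d i j = if does (i ≟ j) then c else d

_·ᵥ_ : ∀ {r} → (Fin r → Fin r → ℤ) → (Fin r → ℤ) → Fin r → ℤ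
(M ·ᵥ x) i = Σℤ (λ j → M i j * x j)

n/gcd : ℕ → ℕ → ℕ
n/gcd r n = quotient (gcd[m,n]∣n r n)

-- Every row of B_{c,d} x equals (c - d) x_i + d Σ x, so the rows differ by (c - d)(x_i - x_j)
-- and add up to (c + (r - 1) d) Σ x.  The two conditions on x therefore say that all entries
-- of y = B_{c,d} x are congruent to a := y_r and that Σ y ≡ 0; given the first, Σ y ≡ r a,
-- and n ∣ r a holds exactly when (n / gcd(r, n)) ∣ a, because n / b and r / b are coprime.
module Submission where

open import Defs
open import Data.Nat using (ℕ; zero; suc; _≤_; NonZero; >-nonZero; ≢-nonZero; ≢-nonZero⁻¹)
import Data.Nat as ℕ
import Data.Nat.Properties as ℕ
import Data.Nat.Divisibility as ℕ
open import Data.Nat.DivMod using (_/_; m/n*n≡m)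
open import Data.Nat.GCD using (gcd; gcd[m,n]∣m; gcd[m,n]∣n; gcd[m,n]≢0)
open import Data.Nat.Coprimality as Coprime using (Coprime; coprime-/gcd; coprime-divisor)
open import Data.Integer using (ℤ; +_; _+_; _-_; _*_; -_)
open import Data.Integer.Properties
  using (+-identityʳ; +-inverseʳ; *-comm; *-assoc; *-distribˡ-+; *-zeroʳ; suc-*; neg-distribʳ-*; abs-*; pos-*)
open import Data.Integer.Divisibility.Signed
  using (_∣_; divides; ∣ᵤ⇒∣; ∣⇒∣ᵤ; ∣m∣n⇒∣m+n; ∣m∣n⇒∣m-n; ∣m⇒∣m*n)
open import Data.Integer.Tactic.RingSolver using (solve-∀)
open import Data.Fin using (Fin; zero; suc; fromℕ; inject₁)
open import Data.Product using (∃; _×_; _,_)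
open import Data.Sum using (inj₂)
open import Function.Base using (_∘_)
open import Function.Bundles using (_⇔_; mk⇔; Equivalence)
open import Relation.Binary.PropositionalEquality
  using (_≡_; refl; sym; trans; cong; cong₂; subst; subst₂; module ≡-Reasoning)

n∣r*n/gcd : ∀ r n → n ℕ.∣ r ℕ.* n/gcd r n
n∣r*n/gcd r n =
  subst (ℕ._∣ r ℕ.* n/gcd r n) (sym (ℕ.m∣n⇒n≡m*quotient (gcd[m,n]∣n r n)))
        (ℕ.*-monoˡ-∣ (n/gcd r n) (gcd[m,n]∣m r n))

n∣r*a⇒n/gcd∣a : ∀ r n {a} .{{_ : NonZero n}} → n ℕ.∣ r ℕ.* a → n/gcd r n ℕ.∣ a
n∣r*a⇒n/gcd∣a r n {a} n∣ra = coprime-divisor q⊥s (ℕ.*-cancelʳ-∣ b qb∣sab)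
  where
  b = gcd r n
  instance
    b≢0 : NonZero b
    b≢0 = ≢-nonZero (gcd[m,n]≢0 r n (inj₂ (≢-nonZero⁻¹ n)))
  q⊥s : Coprime (n/gcd r n) (r / b)
  q⊥s = subst (λ q → Coprime q (r / b)) (ℕ.n/m≡quotient (gcd[m,n]∣n r n))
              (Coprime.sym (coprime-/gcd r n))
  r*a≡s*a*b : r ℕ.* a ≡ r / b ℕ.* a ℕ.* b
  r*a≡s*a*b = begin
    r ℕ.* a                ≡⟨ cong (ℕ._* a) (m/n*n≡m (gcd[m,n]∣m r n)) ⟨
    r / b ℕ.* b ℕ.* a      ≡⟨ ℕ.*-assoc (r / b) b a ⟩
    r / b ℕ.* (b ℕ.* a)    ≡⟨ cong (r / b ℕ.*_) (ℕ.*-comm b a) ⟩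
    r / b ℕ.* (a ℕ.* b)    ≡⟨ ℕ.*-assoc (r / b) a b ⟨
    r / b ℕ.* a ℕ.* b      ∎
    where open ≡-Reasoning
  qb∣sab : n/gcd r n ℕ.* b ℕ.∣ r / b ℕ.* a ℕ.* b
  qb∣sab = subst₂ ℕ._∣_ (ℕ.m∣n⇒n≡quotient*m (gcd[m,n]∣n r n)) r*a≡s*a*b n∣ra

+n∣+r*a⇒+n/gcd∣a : ∀ r n {a} .{{_ : NonZero n}} → + n ∣ + r * a → + n/gcd r n ∣ a
+n∣+r*a⇒+n/gcd∣a r n {a} n∣ra =
  ∣ᵤ⇒∣ (n∣r*a⇒n/gcd∣a r n (subst (n ℕ.∣_) (abs-* (+ r) a) (∣⇒∣ᵤ n∣ra)))

+n∣+r*+n/gcd : ∀ r n → + n ∣ + r * + n/gcd r n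
+n∣+r*+n/gcd r n = subst (+ n ∣_) (pos-* r (n/gcd r n)) (∣ᵤ⇒∣ (n∣r*n/gcd r n))

Σℤ-cong : ∀ {r} {f g : Fin r → ℤ} → (∀ i → f i ≡ g i) → Σℤ f ≡ Σℤ g
Σℤ-cong {zero}  f≗g = refl
Σℤ-cong {suc r} f≗g = cong₂ _+_ (f≗g zero) (Σℤ-cong (f≗g ∘ suc))

Σℤ-distrib-+ : ∀ {r} (f g : Fin r → ℤ) → Σℤ (λ i → f i + g i) ≡ Σℤ f + Σℤ g
Σℤ-distrib-+ {zero}  f g = refl
Σℤ-distrib-+ {suc r} f g =
  trans (cong (_+_ (f zero + g zero)) (Σℤ-distrib-+ (f ∘ suc) (g ∘ suc)))
        (interchange (f zero) (g zero) (Σℤ (f ∘ suc)) (Σℤ (g ∘ suc)))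
  where
  interchange : ∀ a b c d → a + b + (c + d) ≡ a + c + (b + d)
  interchange = solve-∀

*-distribˡ-Σℤ : ∀ {r} k (f : Fin r → ℤ) → k * Σℤ f ≡ Σℤ (λ i → k * f i)
*-distribˡ-Σℤ {zero}  k f = *-zeroʳ k
*-distribˡ-Σℤ {suc r} k f =
  trans (*-distribˡ-+ k (f zero) (Σℤ (f ∘ suc))) (cong (_+_ (k * f zero)) (*-distribˡ-Σℤ k (f ∘ suc)))

Σℤ-const : ∀ r k → Σℤ {r} (λ _ → k) ≡ + r * k
Σℤ-const zero    k = refl
Σℤ-const (suc r) k = trans (cong (_+_ k) (Σℤ-const r k)) (sym (suc-* (+ r) k))

Σℤ-sub-const : ∀ {r} (f : Fin r → ℤ) a → Σℤ (λ i → f i - a) ≡ Σℤ f - + r * a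
Σℤ-sub-const {r} f a =
  trans (Σℤ-distrib-+ f (λ _ → - a))
        (cong (_+_ (Σℤ f)) (trans (Σℤ-const r (- a)) (sym (neg-distribʳ-* (+ r) a))))

∣-Σℤ : ∀ {r k} {f : Fin r → ℤ} → (∀ i → k ∣ f i) → k ∣ Σℤ f
∣-Σℤ {zero}  {k} k∣f = divides (+ 0) refl
∣-Σℤ {suc r}     k∣f = ∣m∣n⇒∣m+n (k∣f zero) (∣-Σℤ (k∣f ∘ suc))

∣Σℤ⇔∣r* : ∀ {r k} (f : Fin r → ℤ) a → (∀ i → k ∣ f i - a) → k ∣ Σℤ f ⇔ k ∣ + r * a
∣Σℤ⇔∣r* {r} {k} f a k∣f-a = mk⇔
  (λ k∣Σf → subst (k ∣_) (cancelˡ (Σℤ f) (+ r * a)) (∣m∣n⇒∣m-n k∣Σf k∣Σf-ra))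
  (λ k∣ra → subst (k ∣_) (cancelʳ (Σℤ f) (+ r * a)) (∣m∣n⇒∣m+n k∣Σf-ra k∣ra))
  where
  k∣Σf-ra : k ∣ Σℤ f - + r * a
  k∣Σf-ra = subst (k ∣_) (Σℤ-sub-const f a) (∣-Σℤ k∣f-a)
  cancelˡ : ∀ s t → s - (s - t) ≡ t
  cancelˡ = solve-∀
  cancelʳ : ∀ s t → s - t + t ≡ s
  cancelʳ = solve-∀

B·ᵥ-row : ∀ {r} c d (x : Fin r → ℤ) i → (B c d ·ᵥ x) i ≡ (c - d) * x i + d * Σℤ x
B·ᵥ-row {suc r} c d x zero =
  trans (cong (_+_ (c * x zero)) (sym (*-distribˡ-Σℤ d (x ∘ suc)))) (split-diagonal c d (x zero) _)
  where
  split-diagonal : ∀ c d a s → c * a + d * s ≡ (c - d) * a + d * (a + s)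
  split-diagonal = solve-∀
B·ᵥ-row {suc r} c d x (suc i) =
  trans (cong (_+_ (d * x zero)) (B·ᵥ-row c d (x ∘ suc) i)) (absorb c d (x zero) (x (suc i)) _)
  where
  absorb : ∀ c d a b s → d * a + ((c - d) * b + d * s) ≡ (c - d) * b + d * (a + s)
  absorb = solve-∀

B·ᵥ-sub : ∀ {r} c d (x : Fin r → ℤ) i j →
          (B c d ·ᵥ x) i - (B c d ·ᵥ x) j ≡ (c - d) * (x i - x j)
B·ᵥ-sub c d x i j =
  trans (cong₂ _-_ (B·ᵥ-row c d x i) (B·ᵥ-row c d x j)) (cancel (c - d) (x i) (x j) (d * Σℤ x))
  where
  cancel : ∀ e a b t → e * a + t - (e * b + t) ≡ e * (a - b)
  cancel = solve-∀

Σℤ-B·ᵥ : ∀ {m} c d (x : Fin (suc m) → ℤ) → Σℤ (B c d ·ᵥ x) ≡ (c + + m * d) * Σℤ x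
Σℤ-B·ᵥ {m} c d x = begin
  Σℤ (B c d ·ᵥ x)                          ≡⟨ Σℤ-cong (B·ᵥ-row c d x) ⟩
  Σℤ (λ i → (c - d) * x i + dΣx)           ≡⟨ Σℤ-distrib-+ (λ i → (c - d) * x i) (λ _ → dΣx) ⟩
  Σℤ (λ i → (c - d) * x i) + Σℤ {suc m} (λ _ → dΣx)
                                           ≡⟨ cong₂ _+_ (sym (*-distribˡ-Σℤ (c - d) x))
                                                        (Σℤ-const (suc m) dΣx) ⟩
  (c - d) * Σℤ x + + suc m * dΣx           ≡⟨ collect c d (Σℤ x) (+ m) ⟩
  (c + + m * d) * Σℤ x                     ∎
  where
  open ≡-Reasoning
  dΣx = d * Σℤ x
  collect : ∀ c d s m → (c - d) * s + (+ 1 + m) * (d * s) ≡ (c + m * d) * s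
  collect = solve-∀

inject₁-fromℕ-elim : ∀ {m} {P : Fin (suc m) → Set} →
                     (∀ j → P (inject₁ j)) → P (fromℕ m) → ∀ i → P i
inject₁-fromℕ-elim {zero}          P-inject₁ P-last zero    = P-last
inject₁-fromℕ-elim {suc m}         P-inject₁ P-last zero    = P-inject₁ zero
inject₁-fromℕ-elim {suc m} {P = P} P-inject₁ P-last (suc i) =
  inject₁-fromℕ-elim {P = P ∘ suc} (P-inject₁ ∘ suc) P-last i

congruent-to-n/gcd-multiple⇔ : ∀ {m} n .{{_ : NonZero n}} (y : Fin (suc m) → ℤ) →
  ((∀ j → + n ∣ y (inject₁ j) - y (fromℕ m)) × + n ∣ Σℤ y)
  ⇔ (∃ λ k → ∀ i → + n ∣ y i - + n/gcd (suc m) n * k)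
congruent-to-n/gcd-multiple⇔ {m} n y = mk⇔ to from
  where
  r = suc m
  q = n/gcd r n
  last = fromℕ m

  to : (∀ j → + n ∣ y (inject₁ j) - y last) × + n ∣ Σℤ y → ∃ λ k → ∀ i → + n ∣ y i - + q * k
  to (n∣y-last , n∣Σy) = k , subst (λ a → ∀ i → + n ∣ y i - a) a≡q*k n∣y-a
    where
    a = y last
    n∣y-a : ∀ i → + n ∣ y i - a
    n∣y-a = inject₁-fromℕ-elim n∣y-last (divides (+ 0) (+-inverseʳ a))
    q∣a : + q ∣ a
    q∣a = +n∣+r*a⇒+n/gcd∣a r n (Equivalence.to (∣Σℤ⇔∣r* y a n∣y-a) n∣Σy)
    k = _∣_.quotient q∣a
    a≡q*k : a ≡ + q * k
    a≡q*k = trans (_∣_.equality q∣a) (*-comm k (+ q))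

  from : (∃ λ k → ∀ i → + n ∣ y i - + q * k) → (∀ j → + n ∣ y (inject₁ j) - y last) × + n ∣ Σℤ y
  from (k , n∣y-qk) = n∣y-last , Equivalence.from (∣Σℤ⇔∣r* y (+ q * k) n∣y-qk) n∣r*qk
    where
    n∣y-last : ∀ j → + n ∣ y (inject₁ j) - y last
    n∣y-last j = subst (+ n ∣_) (cancel (y (inject₁ j)) (y last) (+ q * k))
                       (∣m∣n⇒∣m-n (n∣y-qk (inject₁ j)) (n∣y-qk last))
      where
      cancel : ∀ a b t → a - t - (b - t) ≡ a - b
      cancel = solve-∀
    n∣r*qk : + n ∣ + r * (+ q * k)
    n∣r*qk = subst (+ n ∣_) (*-assoc (+ r) (+ q) k) (∣m⇒∣m*n k (+n∣+r*+n/gcd r n))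

≡0[mod]⇒∣ : ∀ {n t} → t ≡ + 0 [mod n ] → + n ∣ t
≡0[mod]⇒∣ {n} {t} t≡0 = subst (+ n ∣_) (+-identityʳ t) (∣ᵤ⇒∣ t≡0)

∣⇒≡0[mod] : ∀ {n t} → + n ∣ t → t ≡ + 0 [mod n ]
∣⇒≡0[mod] {n} {t} n∣t = ∣⇒∣ᵤ (subst (+ n ∣_) (sym (+-identityʳ t)) n∣t)

lemma6p4 : (m n : ℕ) → 1 ≤ n → (c d : ℤ) → (x : Fin (suc m) → ℤ) →
    (((i : Fin m) → (c - d) * (x (inject₁ i) - x (fromℕ m)) ≡ + 0 [mod n ])
      × ((c + (+ m) * d) * Σℤ x ≡ + 0 [mod n ]))
    ⇔ (∃ λ (k : ℤ) → (i : Fin (suc m)) →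
         (B c d ·ᵥ x) i ≡ (+ (n/gcd (suc m) n)) * k [mod n ])
lemma6p4 m n 1≤n c d x = mk⇔
  (λ (x-diffs , x-sum) →
    let k , y≡q*k = to ((λ j → subst (+ n ∣_) (sym (row-diff j)) (≡0[mod]⇒∣ (x-diffs j)))
                       , subst (+ n ∣_) (sym (Σℤ-B·ᵥ c d x)) (≡0[mod]⇒∣ x-sum))
    in k , ∣⇒∣ᵤ ∘ y≡q*k)
  (λ (k , y≡q*k) →
    let y-diffs , y-sum = from (k , ∣ᵤ⇒∣ ∘ y≡q*k)
    in (λ j → ∣⇒≡0[mod] (subst (+ n ∣_) (row-diff j) (y-diffs j)))
       , ∣⇒≡0[mod] (subst (+ n ∣_) (Σℤ-B·ᵥ c d x) y-sum))
  where
  instance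
    n≢0 : NonZero n
    n≢0 = >-nonZero 1≤n
  open Equivalence (congruent-to-n/gcd-multiple⇔ n (B c d ·ᵥ x))
  row-diff : ∀ j → (B c d ·ᵥ x) (inject₁ j) - (B c d ·ᵥ x) (fromℕ m)
                   ≡ (c - d) * (x (inject₁ j) - x (fromℕ m))
  row-diff j = B·ᵥ-sub c d x (inject₁ j) (fromℕ m)
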